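{- Let $m \geq 3$ be an odd integer. Then the Nest graph $\mathcal{N}(2m;2,m,m+2;1)$ is arc-transitive and its vertex stabilizers (in the full automorphism group) have order $12$.
   Context: For integers $n \geq 4$ and $1 \leq a,b,c,k \leq n-1$ with $k \neq n/2$ and $a,b,c$ pairwise distinct, the Nest graph $\mathcal{N}(n;a,b,c;k)$ is the graph with vertex set $\{u_i : i \in \mathbb{Z}_n\} \cup \{v_i : i \in \mathbb{Z}_n\}$ and edges $u_iu_{i+1}$, $v_iv_{i+k}$, $u_iv_i$, $u_iv_{i+a}$, $u_iv_{i+b}$, $u_iv_{i+c}$ for $i \in \mathbb{Z}_n$ (indices modulo $n$). Arc-transitive means the automorphism group acts transitively on arcs (ordered pairs of adjacent vertices). -}

module Defs where

open import Data.Nat using (ℕ; zero; suc; _+_)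
open import Data.Nat.DivMod using (_mod_)
open import Data.Fin using (Fin; toℕ)
open import Data.Product using (Σ; _×_; _,_)
open import Data.Sum using (_⊎_)
open import Data.List using (List; length)
open import Data.List.Relation.Unary.Any using (Any)
open import Data.List.Relation.Unary.AllPairs using (AllPairs)
open import Relation.Binary.PropositionalEquality using (_≡_)
open import Relation.Nullary using (¬_)
open import Function.Bundles using (_⇔_)

_⊕_ : ∀ {n} → Fin n → ℕ → Fin n
_⊕_ {suc n} i a = (toℕ i + a) mod (suc n)

data Vtx (n : ℕ) : Set where
  u : Fin n → Vtx n
  v : Fin n → Vtx n

-- adjacency of the Nest graph N(n; a, b, c; k):
-- edges u_i u_{i+1}, v_i v_{i+k}, u_i v_i, u_i v_{i+a}, u_i v_{i+b}, u_i v_{i+c}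
-- (undirected: both orientations are listed)
NestAdj : (n a b c k : ℕ) → Vtx n → Vtx n → Set
NestAdj n a b c k (u i) (u j) = (j ≡ i ⊕ 1) ⊎ (i ≡ j ⊕ 1)
NestAdj n a b c k (v i) (v j) = (j ≡ i ⊕ k) ⊎ (i ≡ j ⊕ k)
NestAdj n a b c k (u i) (v j) = (j ≡ i) ⊎ (j ≡ i ⊕ a) ⊎ (j ≡ i ⊕ b) ⊎ (j ≡ i ⊕ c)
NestAdj n a b c k (v j) (u i) = (j ≡ i) ⊎ (j ≡ i ⊕ a) ⊎ (j ≡ i ⊕ b) ⊎ (j ≡ i ⊕ c)

record Automorphism {V : Set} (E : V → V → Set) : Set where
  field
    fun      : V → V
    inv      : V → V
    inverseˡ : ∀ x → fun (inv x) ≡ x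
    inverseʳ : ∀ x → inv (fun x) ≡ x
    adj      : ∀ x y → E x y ⇔ E (fun x) (fun y)
open Automorphism public

ArcTransitive : {V : Set} → (V → V → Set) → Set
ArcTransitive {V} E =
  ∀ x y x' y' → E x y → E x' y' →
  Σ (Automorphism E) λ φ → (fun φ x ≡ x') × (fun φ y ≡ y')

SameAut : {V : Set} {E : V → V → Set} → Automorphism E → Automorphism E → Set
SameAut φ ψ = ∀ x → fun φ x ≡ fun ψ x

StabilizerOrder : {V : Set} → (V → V → Set) → V → ℕ → Set
StabilizerOrder {V} E x s =
  Σ (List (Σ (Automorphism E) λ φ → fun φ x ≡ x)) λ L →
    (length L ≡ s) ×
    AllPairs (λ p q → ¬ SameAut (Σ.proj₁ p) (Σ.proj₁ q)) L ×
    (∀ (φ : Automorphism E) → fun φ x ≡ x → Any (λ p → SameAut φ (Σ.proj₁ p)) L)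

-- The residues of an index modulo m and modulo 2 determine it, as m is odd, and under this
-- identification u_i ↦ (i mod m, i mod 2) and v_j ↦ (j - 1 mod m, 2 + j mod 2) is an isomorphism
-- from N(2m; 2, m, m + 2; 1) onto the tensor product C_m ⊗ K_4 (layers in C_m, labels in K_4).
-- Automorphisms of C_m and permutations of the four labels combine to automorphisms of the
-- product, which therefore is arc-transitive.  Conversely, since m ≥ 3 the two neighbours of a
-- vertex of C_m are distinct and C_m has no 4-cycle (m odd), so two vertices of C_m ⊗ K_4 have
-- four common neighbours exactly when they lie in the same layer.  Hence every automorphism maps
-- layers to layers, acting as an automorphism of C_m on them and as a permutation on the labels.
-- The stabilizer of a vertex is then {identity, reflection} × Sym(3), of order 2 · 6 = 12.

module Submission where

open import Defs
open import Data.Nat using (ℕ; zero; suc; _+_; _*_; _∸_; _≤_; _<_; NonZero; s≤s)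
open import Data.Nat.Properties
  using (+-comm; +-assoc; +-identityˡ; +-identityʳ; *-assoc; m+[n∸m]≡n; <⇒≤; <⇒≱; ≤-total; ≤-trans; m≤m+n; +-monoˡ-<)
open import Data.Nat.DivMod
  using (_%_; _mod_; %-distribˡ-+; m%n%n≡m%n; n%n≡0; m%n<n; m<n⇒m%n≡m; m∣n⇒o%n%m≡o%m)
open import Data.Nat.Divisibility using (_∣_; divides; n∣m⇒m%n≡0; m%n≡0⇒n∣m; n∣m*n; m∣m*n; ∣⇒≤)
open import Data.Nat.Primality using (euclidsLemma; prime[2])
open import Data.Fin using (Fin; toℕ; fromℕ<; punchIn; punchOut; _≟_; _↑ˡ_; _↑ʳ_; splitAt) renaming (suc to fsuc)
open import Data.Fin.Patterns using (0F; 1F)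
open import Data.Fin.Properties
  using (toℕ-injective; toℕ<n; toℕ-fromℕ<; punchIn-punchOut; punchIn-injective; punchInᵢ≢i; injective⇒≤;
         ↑ˡ-injective; ↑ʳ-injective; splitAt-↑ˡ; splitAt-↑ʳ; splitAt⁻¹-↑ˡ; splitAt⁻¹-↑ʳ)
open import Data.Fin.Permutation using (Permutation′; _⟨$⟩ʳ_; _⟨$⟩ˡ_; insert; remove; insert-punchIn; insert-remove)
import Data.Fin.Permutation as Perm
open import Data.List using (List; []; _∷_; length; map; lookup; allFin; cartesianProduct; cartesianProductWith)
open import Data.List.Properties using (length-map)
open import Data.List.Membership.Propositional using (_∈_)
open import Data.List.Membership.Propositional.Properties
  using (∈-cartesianProduct⁺; ∈-cartesianProductWith⁺; ∈-allFin; ∈-lookup)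
open import Data.List.Relation.Unary.Any using (Any; here)
import Data.List.Relation.Unary.Any as Any
import Data.List.Relation.Unary.Any.Properties as Any
import Data.List.Relation.Unary.All as All
import Data.List.Relation.Unary.AllPairs as AllPairs
import Data.List.Relation.Unary.AllPairs.Properties as AllPairs
open import Data.List.Relation.Unary.Unique.Propositional using (Unique)
import Data.List.Relation.Unary.Unique.Propositional.Properties as Unique
open import Data.Product using (Σ; _×_; _,_; proj₁; proj₂)
open import Data.Product.Function.NonDependent.Propositional using (_×-⇔_)
open import Data.Sum using (_⊎_; inj₁; inj₂; [_,_]′)
open import Function.Bundles using (_⇔_; mk⇔; Equivalence)
open import Function.Construct.Composition using (_⇔-∘_)
open import Function.Related.TypeIsomorphisms using (¬-cong-⇔)
open import Relation.Binary.Bundles using (Setoid)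
open import Relation.Binary.PropositionalEquality
open import Relation.Nullary using (¬_; contradiction; yes; no)
import Relation.Binary.Reasoning.Setoid as SetoidReasoning

-- Congruences of natural numbers

record ModEq (d : ℕ) .{{_ : NonZero d}} (a b : ℕ) : Set where
  constructor mod-≡
  field %-≡ : a % d ≡ b % d

infix 4 ModEq
syntax ModEq d a b = a ≡ b [mod d ]

module _ {d : ℕ} .{{_ : NonZero d}} where

  ≡⇒≡-mod : ∀ {a b} → a ≡ b → a ≡ b [mod d ]
  ≡⇒≡-mod refl = mod-≡ refl

  mod-sym : ∀ {a b} → a ≡ b [mod d ] → b ≡ a [mod d ]
  mod-sym (mod-≡ p) = mod-≡ (sym p)

  mod-trans : ∀ {a b c} → a ≡ b [mod d ] → b ≡ c [mod d ] → a ≡ c [mod d ]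
  mod-trans (mod-≡ p) (mod-≡ q) = mod-≡ (trans p q)

mod-setoid : (d : ℕ) .{{_ : NonZero d}} → Setoid _ _
mod-setoid d = record
  { Carrier = ℕ
  ; _≈_ = ModEq d
  ; isEquivalence = record { refl = ≡⇒≡-mod refl ; sym = mod-sym ; trans = mod-trans }
  }

module ≡-mod-Reasoning (d : ℕ) .{{_ : NonZero d}} = SetoidReasoning (mod-setoid d)

neg : (d : ℕ) .{{_ : NonZero d}} → ℕ → ℕ
neg d a = d ∸ a % d

module _ {d : ℕ} .{{_ : NonZero d}} where

  +-cong-mod : ∀ {a b c e} → a ≡ b [mod d ] → c ≡ e [mod d ] → a + c ≡ b + e [mod d ]
  +-cong-mod {a} {b} {c} {e} (mod-≡ p) (mod-≡ q) = mod-≡ (begin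
    (a + c) % d          ≡⟨ %-distribˡ-+ a c d ⟩
    (a % d + c % d) % d  ≡⟨ cong₂ (λ x y → (x + y) % d) p q ⟩
    (b % d + e % d) % d  ≡⟨ %-distribˡ-+ b e d ⟨
    (b + e) % d          ∎)
    where open ≡-Reasoning

  +-congˡ-mod : ∀ c {a b} → a ≡ b [mod d ] → c + a ≡ c + b [mod d ]
  +-congˡ-mod c = +-cong-mod (≡⇒≡-mod refl)

  +-congʳ-mod : ∀ c {a b} → a ≡ b [mod d ] → a + c ≡ b + c [mod d ]
  +-congʳ-mod c p = +-cong-mod p (≡⇒≡-mod refl)

  %-≡-mod : ∀ a → a % d ≡ a [mod d ]
  %-≡-mod a = mod-≡ (m%n%n≡m%n a d)

  0%d≡0 : 0 % d ≡ 0
  0%d≡0 = n∣m⇒m%n≡0 0 d (divides 0 refl)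

  d≡0-mod : d ≡ 0 [mod d ]
  d≡0-mod = mod-≡ (trans (n%n≡0 d) (sym 0%d≡0))

  +-d-mod : ∀ a → a + d ≡ a [mod d ]
  +-d-mod a = mod-trans (+-congˡ-mod a d≡0-mod) (≡⇒≡-mod (+-identityʳ a))

  ≡0-mod⇒∣ : ∀ {t} → t ≡ 0 [mod d ] → d ∣ t
  ≡0-mod⇒∣ {t} (mod-≡ p) = m%n≡0⇒n∣m t d (trans p 0%d≡0)

  ∣⇒≡0-mod : ∀ {t} → d ∣ t → t ≡ 0 [mod d ]
  ∣⇒≡0-mod {t} p = mod-≡ (trans (n∣m⇒m%n≡0 t d p) (sym 0%d≡0))

  +-neg-mod : ∀ a → a + neg d a ≡ 0 [mod d ]
  +-neg-mod a = begin
    a + neg d a          ≈⟨ +-congʳ-mod (neg d a) (%-≡-mod a) ⟨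
    a % d + (d ∸ a % d)  ≡⟨ m+[n∸m]≡n (<⇒≤ (m%n<n a d)) ⟩
    d                    ≈⟨ d≡0-mod ⟩
    0                    ∎
    where open ≡-mod-Reasoning d

  +-cancelˡ-mod : ∀ c {a b} → c + a ≡ c + b [mod d ] → a ≡ b [mod d ]
  +-cancelˡ-mod c {a} {b} p = begin
    a                  ≡⟨ +-identityˡ a ⟨
    0 + a              ≈⟨ +-congʳ-mod a neg+c ⟨
    neg d c + c + a    ≡⟨ +-assoc (neg d c) c a ⟩
    neg d c + (c + a)  ≈⟨ +-congˡ-mod (neg d c) p ⟩
    neg d c + (c + b)  ≡⟨ +-assoc (neg d c) c b ⟨
    neg d c + c + b    ≈⟨ +-congʳ-mod b neg+c ⟩
    0 + b              ≡⟨ +-identityˡ b ⟩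
    b                  ∎
    where
    open ≡-mod-Reasoning d
    neg+c : neg d c + c ≡ 0 [mod d ]
    neg+c = mod-trans (≡⇒≡-mod (+-comm (neg d c) c)) (+-neg-mod c)

  +-cancelʳ-mod : ∀ c {a b} → a + c ≡ b + c [mod d ] → a ≡ b [mod d ]
  +-cancelʳ-mod c {a} {b} p =
    +-cancelˡ-mod c (mod-trans (≡⇒≡-mod (+-comm c a)) (mod-trans p (≡⇒≡-mod (+-comm b c))))

  <-≡-mod⇒≡ : ∀ {a b} → a < d → b < d → a ≡ b [mod d ] → a ≡ b
  <-≡-mod⇒≡ a<d b<d (mod-≡ p) = trans (sym (m<n⇒m%n≡m a<d)) (trans p (m<n⇒m%n≡m b<d))

  toℕ-injective-mod : ∀ {i j : Fin d} → toℕ i ≡ toℕ j [mod d ] → i ≡ j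
  toℕ-injective-mod {i} {j} p = toℕ-injective (<-≡-mod⇒≡ (toℕ<n i) (toℕ<n j) p)

  toℕ-mod : ∀ a → toℕ (a mod d) ≡ a [mod d ]
  toℕ-mod a = mod-trans (≡⇒≡-mod (toℕ-fromℕ< (m%n<n a d))) (%-≡-mod a)

  ≡-+-mod⇒∣ : ∀ a {t} → a ≡ a + t [mod d ] → d ∣ t
  ≡-+-mod⇒∣ a p = ≡0-mod⇒∣ (mod-sym (+-cancelˡ-mod a (mod-trans (≡⇒≡-mod (+-identityʳ a)) p)))

  ∣⇒≡-+-mod : ∀ a {t} → d ∣ t → a ≡ a + t [mod d ]
  ∣⇒≡-+-mod a p = mod-trans (≡⇒≡-mod (sym (+-identityʳ a))) (+-congˡ-mod a (mod-sym (∣⇒≡0-mod p)))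

≡-mod-∣ : ∀ {d e a b} .{{_ : NonZero d}} .{{_ : NonZero e}} → d ∣ e → a ≡ b [mod e ] → a ≡ b [mod d ]
≡-mod-∣ {d} {e} {a} {b} d∣e (mod-≡ p) =
  mod-≡ (trans (sym (m∣n⇒o%n%m≡o%m d e a d∣e)) (trans (cong (_% d) p) (m∣n⇒o%n%m≡o%m d e b d∣e)))

odd-∣-double : ∀ {m t} → ¬ 2 ∣ m → m ∣ t → 2 ∣ t → 2 * m ∣ t
odd-∣-double {m} m-odd (divides q refl) 2∣qm with euclidsLemma q m prime[2] 2∣qm
... | inj₂ 2∣m = contradiction 2∣m m-odd
... | inj₁ (divides r refl) = divides r (*-assoc r 2 m)

module _ {m : ℕ} .{{_ : NonZero m}} .{{_ : NonZero (2 * m)}} (m-odd : ¬ 2 ∣ m) where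

  private
    crt-≤ : ∀ {a b} → a ≤ b → a ≡ b [mod m ] → a ≡ b [mod 2 ] → a ≡ b [mod 2 * m ]
    crt-≤ {a} a≤b p q rewrite sym (m+[n∸m]≡n a≤b) =
      ∣⇒≡-+-mod a (odd-∣-double m-odd (≡-+-mod⇒∣ a p) (≡-+-mod⇒∣ a q))

  crt-mod : ∀ {a b} → a ≡ b [mod m ] → a ≡ b [mod 2 ] → a ≡ b [mod 2 * m ]
  crt-mod {a} {b} p q with ≤-total a b
  ... | inj₁ a≤b = crt-≤ a≤b p q
  ... | inj₂ b≤a = mod-sym (crt-≤ b≤a (mod-sym p) (mod-sym q))

%2≡0⊎%2≡1 : ∀ a → a % 2 ≡ 0 ⊎ a % 2 ≡ 1
%2≡0⊎%2≡1 a with a % 2 | m%n<n a 2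
... | 0 | _ = inj₁ refl
... | 1 | _ = inj₂ refl
... | suc (suc _) | s≤s (s≤s ())

mod-2-dichotomy : ∀ a b → a ≡ b [mod 2 ] ⊎ a ≡ b + 1 [mod 2 ]
mod-2-dichotomy a b with %2≡0⊎%2≡1 a | %2≡0⊎%2≡1 b
... | inj₁ a0 | inj₁ b0 = inj₁ (mod-≡ (trans a0 (sym b0)))
... | inj₂ a1 | inj₂ b1 = inj₁ (mod-≡ (trans a1 (sym b1)))
... | inj₁ a0 | inj₂ b1 = inj₂ (mod-≡ (trans a0 (sym (trans (%-distribˡ-+ b 1 2) (cong (λ r → (r + 1) % 2) b1)))))
... | inj₂ a1 | inj₁ b0 = inj₂ (mod-≡ (trans a1 (sym (trans (%-distribˡ-+ b 1 2) (cong (λ r → (r + 1) % 2) b0)))))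

≢+1-mod-2 : ∀ a → ¬ a ≡ a + 1 [mod 2 ]
≢+1-mod-2 a p with ≡-+-mod⇒∣ a p
... | divides zero ()
... | divides (suc _) ()

odd⇒≡1-mod-2 : ∀ {m} → ¬ 2 ∣ m → m ≡ 1 [mod 2 ]
odd⇒≡1-mod-2 {m} m-odd with mod-2-dichotomy m 0
... | inj₁ m≡0 = contradiction (≡0-mod⇒∣ m≡0) m-odd
... | inj₂ m≡1 = m≡1

≢-mod-2⇒+1 : ∀ {a b} → ¬ a ≡ b [mod 2 ] → a ≡ b + 1 [mod 2 ]
≢-mod-2⇒+1 {a} {b} a≢b with mod-2-dichotomy a b
... | inj₁ a≡b = contradiction a≡b a≢b
... | inj₂ a≡b+1 = a≡b+1

module _ {k : ℕ} where

  toℕ-⊕ : ∀ (i : Fin (suc k)) a → toℕ (i ⊕ a) ≡ toℕ i + a [mod suc k ]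
  toℕ-⊕ i a = toℕ-mod (toℕ i + a)

  ≡⊕⇒≡-mod : ∀ {i j : Fin (suc k)} {a} → j ≡ i ⊕ a → toℕ j ≡ toℕ i + a [mod suc k ]
  ≡⊕⇒≡-mod {i} {a = a} refl = toℕ-⊕ i a

  ≡-mod⇒≡⊕ : ∀ {i j : Fin (suc k)} {a} → toℕ j ≡ toℕ i + a [mod suc k ] → j ≡ i ⊕ a
  ≡-mod⇒≡⊕ {i} {a = a} p = toℕ-injective-mod (mod-trans p (mod-sym (toℕ-⊕ i a)))

  ⊕-identityʳ : ∀ (i : Fin (suc k)) → i ⊕ 0 ≡ i
  ⊕-identityʳ i = sym (≡-mod⇒≡⊕ {i = i} (≡⇒≡-mod (sym (+-identityʳ (toℕ i)))))

  ⊕-cancel : ∀ (x : Fin (suc k)) {a b} → a + b ≡ 0 [mod suc k ] → (x ⊕ a) ⊕ b ≡ x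
  ⊕-cancel x {a} {b} a+b≡0 = toℕ-injective-mod (begin
    toℕ ((x ⊕ a) ⊕ b)  ≈⟨ toℕ-⊕ (x ⊕ a) b ⟩
    toℕ (x ⊕ a) + b    ≈⟨ +-congʳ-mod b (toℕ-⊕ x a) ⟩
    toℕ x + a + b      ≡⟨ +-assoc (toℕ x) a b ⟩
    toℕ x + (a + b)    ≈⟨ +-congˡ-mod (toℕ x) a+b≡0 ⟩
    toℕ x + 0          ≡⟨ +-identityʳ (toℕ x) ⟩
    toℕ x              ∎)
    where open ≡-mod-Reasoning (suc k)

  [x⊕k]⊕1≡x : ∀ (x : Fin (suc k)) → (x ⊕ k) ⊕ 1 ≡ x
  [x⊕k]⊕1≡x x = ⊕-cancel x (mod-trans (≡⇒≡-mod (+-comm k 1)) d≡0-mod)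

  mod-suc : ∀ j → suc j mod suc k ≡ (j mod suc k) ⊕ 1
  mod-suc j = ≡-mod⇒≡⊕ {i = j mod suc k}
    (mod-trans (toℕ-mod (suc j)) (mod-trans (≡⇒≡-mod (+-comm 1 j)) (+-congʳ-mod 1 (mod-sym (toℕ-mod j)))))

  toℕ-mod-inverse : ∀ (x : Fin (suc k)) → toℕ x mod suc k ≡ x
  toℕ-mod-inverse x = toℕ-injective-mod (toℕ-mod (toℕ x))

record Iso {V W : Set} (E : V → V → Set) (F : W → W → Set) : Set where
  field
    to        : V → W
    from      : W → V
    to∘from   : ∀ y → to (from y) ≡ y
    from∘to   : ∀ x → from (to x) ≡ x
    adjacency : ∀ x y → E x y ⇔ F (to x) (to y)

module _ {V : Set} {E : V → V → Set} where

  aut⇒iso : Automorphism E → Iso E E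
  aut⇒iso φ = record
    { to = fun φ ; from = inv φ ; to∘from = inverseˡ φ ; from∘to = inverseʳ φ ; adjacency = adj φ }

  iso⇒aut : Iso E E → Automorphism E
  iso⇒aut I = record
    { fun = to ; inv = from ; inverseˡ = to∘from ; inverseʳ = from∘to ; adj = adjacency }
    where open Iso I

  aut-id : Automorphism E
  aut-id = record
    { fun = λ x → x ; inv = λ x → x ; inverseˡ = λ _ → refl ; inverseʳ = λ _ → refl
    ; adj = λ _ _ → mk⇔ (λ e → e) (λ e → e)
    }

  fun-injective : (φ : Automorphism E) → ∀ {x y} → fun φ x ≡ fun φ y → x ≡ y
  fun-injective φ {x} {y} eq = trans (sym (inverseʳ φ x)) (trans (cong (inv φ) eq) (inverseʳ φ y))

module _ {V W : Set} {E : V → V → Set} {F : W → W → Set} where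

  iso-sym : Iso E F → Iso F E
  iso-sym I = record
    { to = from ; from = to ; to∘from = from∘to ; from∘to = to∘from
    ; adjacency = λ x y → mk⇔
        (λ e → Equivalence.from (adjacency (from x) (from y)) (subst₂ F (sym (to∘from x)) (sym (to∘from y)) e))
        (λ e → subst₂ F (to∘from x) (to∘from y) (Equivalence.to (adjacency (from x) (from y)) e))
    }
    where open Iso I

module _ {U V W : Set} {E : U → U → Set} {F : V → V → Set} {G : W → W → Set} where

  iso-trans : Iso E F → Iso F G → Iso E G
  iso-trans I J = record
    { to = λ x → J.to (I.to x)
    ; from = λ z → I.from (J.from z)
    ; to∘from = λ z → trans (cong J.to (I.to∘from (J.from z))) (J.to∘from z)
    ; from∘to = λ x → trans (cong I.from (J.from∘to (I.to x))) (I.from∘to x)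
    ; adjacency = λ x y → mk⇔
        (λ e → Equivalence.to (J.adjacency _ _) (Equivalence.to (I.adjacency x y) e))
        (λ e → Equivalence.from (I.adjacency x y) (Equivalence.from (J.adjacency _ _) e))
    }
    where
    module I = Iso I
    module J = Iso J

aut-inverse : {V : Set} {E : V → V → Set} → Automorphism E → Automorphism E
aut-inverse φ = iso⇒aut (iso-sym (aut⇒iso φ))

conjugate : {V W : Set} {E : V → V → Set} {F : W → W → Set} → Iso E F → Automorphism F → Automorphism E
conjugate I φ = iso⇒aut (iso-trans I (iso-trans (aut⇒iso φ) (iso-sym I)))

module _ {V W : Set} {E : V → V → Set} {F : W → W → Set} (I : Iso E F) where
  open Iso I

  conjugate-reflects-SameAut : ∀ φ ψ → SameAut (conjugate I φ) (conjugate I ψ) → SameAut φ ψ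
  conjugate-reflects-SameAut φ ψ same y = begin
    fun φ y                          ≡⟨ cong (fun φ) (to∘from y) ⟨
    fun φ (to (from y))              ≡⟨ to∘from _ ⟨
    to (from (fun φ (to (from y))))  ≡⟨ cong to (same (from y)) ⟩
    to (from (fun ψ (to (from y))))  ≡⟨ to∘from _ ⟩
    fun ψ (to (from y))              ≡⟨ cong (fun ψ) (to∘from y) ⟩
    fun ψ y                          ∎
    where open ≡-Reasoning

  arcTransitive-transport : ArcTransitive F → ArcTransitive E
  arcTransitive-transport F-arc x y x' y' e e'
    with F-arc (to x) (to y) (to x') (to y') (Equivalence.to (adjacency x y) e) (Equivalence.to (adjacency x' y') e')
  ... | φ , φx , φy = conjugate I φ , trans (cong from φx) (from∘to x') , trans (cong from φy) (from∘to y')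

  stabilizerOrder-transport : ∀ x s → StabilizerOrder F (to x) s → StabilizerOrder E x s
  stabilizerOrder-transport x s (L , |L| , distinct , complete) =
    map conjugate-fixing L ,
    trans (length-map conjugate-fixing L) |L| ,
    AllPairs.map⁺ (AllPairs.map (λ {p} {q} ne same → ne (conjugate-reflects-SameAut (proj₁ p) (proj₁ q) same)) distinct) ,
    λ θ θx → Any.map⁺ (Any.map (λ {p} → conjugate-back θ (proj₁ p))
                               (complete (conjugate (iso-sym I) θ) (trans (cong (λ z → to (fun θ z)) (from∘to x)) (cong to θx))))
    where
    conjugate-fixing : Σ (Automorphism F) (λ φ → fun φ (to x) ≡ to x) → Σ (Automorphism E) (λ φ → fun φ x ≡ x)
    conjugate-fixing (φ , φx) = conjugate I φ , trans (cong from φx) (from∘to x)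

    conjugate-back : ∀ θ φ → SameAut (conjugate (iso-sym I) θ) φ → SameAut θ (conjugate I φ)
    conjugate-back θ φ same z = begin
      fun θ z                          ≡⟨ from∘to _ ⟨
      from (to (fun θ z))              ≡⟨ cong (λ w → from (to (fun θ w))) (from∘to z) ⟨
      from (to (fun θ (from (to z))))  ≡⟨ cong from (same (to z)) ⟩
      from (fun φ (to z))              ∎
      where open ≡-Reasoning

stabilizerOrder-invariant : {V : Set} {E : V → V → Set} (ψ : Automorphism E) → ∀ x s →
                            StabilizerOrder E (fun ψ x) s → StabilizerOrder E x s
stabilizerOrder-invariant ψ = stabilizerOrder-transport (aut⇒iso ψ)

infixr 7 _⊗_

_⊗_ : {V W : Set} → (V → V → Set) → (W → W → Set) → V × W → V × W → Set
(E ⊗ F) (x , c) (y , d) = E x y × F c d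

module _ {V W : Set} {E : V → V → Set} {F : W → W → Set} where

  _⊗-aut_ : Automorphism E → Automorphism F → Automorphism (E ⊗ F)
  φ ⊗-aut ψ = record
    { fun = λ { (x , c) → fun φ x , fun ψ c }
    ; inv = λ { (x , c) → inv φ x , inv ψ c }
    ; inverseˡ = λ { (x , c) → cong₂ _,_ (inverseˡ φ x) (inverseˡ ψ c) }
    ; inverseʳ = λ { (x , c) → cong₂ _,_ (inverseʳ φ x) (inverseʳ ψ c) }
    ; adj = λ { (x , c) (y , d) → mk⇔
        (λ { (e , f) → Equivalence.to (adj φ x y) e , Equivalence.to (adj ψ c d) f })
        (λ { (e , f) → Equivalence.from (adj φ x y) e , Equivalence.from (adj ψ c d) f }) }
    }

  ⊗-arcTransitive : ArcTransitive E → ArcTransitive F → ArcTransitive (E ⊗ F)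
  ⊗-arcTransitive E-arc F-arc (x , c) (y , d) (x' , c') (y' , d') (e , f) (e' , f')
    with E-arc x y x' y' e e' | F-arc c d c' d' f f'
  ... | φ , φx , φy | ψ , ψc , ψd = φ ⊗-aut ψ , cong₂ _,_ φx ψc , cong₂ _,_ φy ψd

Complete : (n : ℕ) → Fin n → Fin n → Set
Complete n c d = ¬ c ≡ d

perm-aut : ∀ {n} → Permutation′ n → Automorphism (Complete n)
perm-aut σ = record
  { fun = σ ⟨$⟩ʳ_
  ; inv = σ ⟨$⟩ˡ_
  ; inverseˡ = λ _ → Perm.inverseʳ σ
  ; inverseʳ = λ _ → Perm.inverseˡ σ
  ; adj = λ c d → mk⇔ (λ c≢d σc≡σd → c≢d (σ-injective σc≡σd)) (λ σc≢σd c≡d → σc≢σd (cong (σ ⟨$⟩ʳ_) c≡d))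
  }
  where
  σ-injective : ∀ {c d} → σ ⟨$⟩ʳ c ≡ σ ⟨$⟩ʳ d → c ≡ d
  σ-injective {c} {d} eq = trans (sym (Perm.inverseˡ σ)) (trans (cong (σ ⟨$⟩ˡ_) eq) (Perm.inverseˡ σ))

module _ {m n : ℕ} (i : Fin (suc m)) (j : Fin (suc n)) where

  insert-matchˡ : ∀ (π : Perm.Permutation m n) → insert i j π ⟨$⟩ʳ i ≡ j
  insert-matchˡ π with i ≟ i
  ... | yes _ = refl
  ... | no i≢i = contradiction refl i≢i

  insert-cong : ∀ (π ρ : Perm.Permutation m n) → (∀ k → π ⟨$⟩ʳ k ≡ ρ ⟨$⟩ʳ k) →
                ∀ k → insert i j π ⟨$⟩ʳ k ≡ insert i j ρ ⟨$⟩ʳ k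
  insert-cong π ρ π≈ρ k with i ≟ k
  ... | yes _ = refl
  ... | no i≢k = cong (punchIn j) (π≈ρ (punchOut i≢k))

-- σ sends c ↦ c' and, once c and c' are punched out, e ↦ e'.
complete-arcTransitive : ∀ n → ArcTransitive (Complete n)
complete-arcTransitive (suc zero) 0F 0F _ _ c≢e _ = contradiction refl c≢e
complete-arcTransitive (suc (suc n)) c e c' e' c≢e c'≢e' =
  perm-aut σ , insert-matchˡ c c' ρ , (begin
    insert c c' ρ ⟨$⟩ʳ e                         ≡⟨ cong (insert c c' ρ ⟨$⟩ʳ_) (punchIn-punchOut c≢e) ⟨
    insert c c' ρ ⟨$⟩ʳ punchIn c (punchOut c≢e)  ≡⟨ insert-punchIn c c' ρ (punchOut c≢e) ⟩
    punchIn c' (ρ ⟨$⟩ʳ punchOut c≢e)             ≡⟨ cong (punchIn c') (insert-matchˡ (punchOut c≢e) (punchOut c'≢e') Perm.id) ⟩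
    punchIn c' (punchOut c'≢e')                  ≡⟨ punchIn-punchOut c'≢e' ⟩
    e'                                           ∎)
  where
  open ≡-Reasoning
  ρ = insert (punchOut c≢e) (punchOut c'≢e') Perm.id
  σ = insert c c' ρ

-- Lehmer codes of permutations

infixr 5 _∷_

data LehmerCode : ℕ → Set where
  []  : LehmerCode zero
  _∷_ : ∀ {n} → Fin (suc n) → LehmerCode n → LehmerCode (suc n)

decode : ∀ {n} → LehmerCode n → Permutation′ n
decode [] = Perm.id
decode (i ∷ c) = insert 0F i (decode c)

decode-injective : ∀ {n} (c c' : LehmerCode n) → (∀ k → decode c ⟨$⟩ʳ k ≡ decode c' ⟨$⟩ʳ k) → c ≡ c'
decode-injective [] [] _ = refl
decode-injective (i ∷ c) (i' ∷ c') same = cong₂ _∷_ (same 0F) (decode-injective c c' tail-same)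
  where
  tail-same : ∀ k → decode c ⟨$⟩ʳ k ≡ decode c' ⟨$⟩ʳ k
  tail-same k = punchIn-injective i _ _ (begin
    punchIn i (decode c ⟨$⟩ʳ k)    ≡⟨ insert-punchIn 0F i (decode c) k ⟨
    decode (i ∷ c) ⟨$⟩ʳ fsuc k     ≡⟨ same (fsuc k) ⟩
    decode (i' ∷ c') ⟨$⟩ʳ fsuc k   ≡⟨ insert-punchIn 0F i' (decode c') k ⟩
    punchIn i' (decode c' ⟨$⟩ʳ k)  ≡⟨ cong (λ j → punchIn j (decode c' ⟨$⟩ʳ k)) (same 0F) ⟨
    punchIn i (decode c' ⟨$⟩ʳ k)   ∎)
    where open ≡-Reasoning

decode-surjective : ∀ {n} (σ : Permutation′ n) → Σ (LehmerCode n) λ c → ∀ k → σ ⟨$⟩ʳ k ≡ decode c ⟨$⟩ʳ k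
decode-surjective {zero} σ = [] , λ ()
decode-surjective {suc n} σ = (σ ⟨$⟩ʳ 0F) ∷ proj₁ rest , λ k →
  trans (sym (insert-remove 0F σ k)) (insert-cong 0F (σ ⟨$⟩ʳ 0F) (remove 0F σ) (decode (proj₁ rest)) (proj₂ rest) k)
  where
  rest = decode-surjective (remove 0F σ)

allCodes : ∀ n → List (LehmerCode n)
allCodes zero = [] ∷ []
allCodes (suc n) = cartesianProductWith _∷_ (allFin (suc n)) (allCodes n)

∈-allCodes : ∀ {n} (c : LehmerCode n) → c ∈ allCodes n
∈-allCodes [] = here refl
∈-allCodes (i ∷ c) = ∈-cartesianProductWith⁺ _∷_ (∈-allFin i) (∈-allCodes c)

allCodes-unique : ∀ n → Unique (allCodes n)
allCodes-unique zero = All.[] AllPairs.∷ AllPairs.[]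
allCodes-unique (suc n) = Unique.cartesianProductWith⁺ _∷_ ∷-injective (Unique.allFin⁺ (suc n)) (allCodes-unique n)
  where
  ∷-injective : ∀ {i i' : Fin (suc n)} {c c'} → i ∷ c ≡ i' ∷ c' → i ≡ i' × c ≡ c'
  ∷-injective refl = refl , refl

unique-lookup-injective : ∀ {A : Set} {xs : List A} → Unique xs → ∀ i j → lookup xs i ≡ lookup xs j → i ≡ j
unique-lookup-injective (x∉xs AllPairs.∷ xs!) 0F 0F eq = refl
unique-lookup-injective (x∉xs AllPairs.∷ xs!) 0F (fsuc j) eq = contradiction eq (All.lookup x∉xs (∈-lookup j))
unique-lookup-injective (x∉xs AllPairs.∷ xs!) (fsuc i) 0F eq = contradiction (sym eq) (All.lookup x∉xs (∈-lookup i))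
unique-lookup-injective (x∉xs AllPairs.∷ xs!) (fsuc i) (fsuc j) eq = cong fsuc (unique-lookup-injective xs! i j eq)

unique⇒length≤ : ∀ {n} {xs : List (Fin n)} → Unique xs → length xs ≤ n
unique⇒length≤ xs! = injective⇒≤ (unique-lookup-injective xs! _ _)

two-more-points : ∀ {n} {c c' : Fin (suc (suc (suc (suc n))))} → ¬ c ≡ c' →
                  Σ (Fin _) λ d₁ → Σ (Fin _) λ d₂ →
                  ¬ c ≡ d₁ × ¬ c ≡ d₂ × ¬ c' ≡ d₁ × ¬ c' ≡ d₂ × ¬ d₁ ≡ d₂
two-more-points {c = c} {c'} c≢c' =
  punchIn c (punchIn p 0F) , punchIn c (punchIn p 1F) ,
  (λ eq → punchInᵢ≢i c _ (sym eq)) , (λ eq → punchInᵢ≢i c _ (sym eq)) ,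
  c'≢ 0F , c'≢ 1F ,
  (λ eq → contradiction (punchIn-injective p 0F 1F (punchIn-injective c _ _ eq)) λ ())
  where
  p = punchOut c≢c'
  c'≢ : ∀ j → ¬ c' ≡ punchIn c (punchIn p j)
  c'≢ j eq = punchInᵢ≢i p j (sym (punchIn-injective c _ _ (trans (punchIn-punchOut c≢c') eq)))

-- Cycles

Adjacent : (m : ℕ) .{{_ : NonZero m}} → ℕ → ℕ → Set
Adjacent m a b = b ≡ a + 1 [mod m ] ⊎ a ≡ b + 1 [mod m ]

module _ {m : ℕ} .{{_ : NonZero m}} where

  adjacent-sym : ∀ {a b} → Adjacent m a b → Adjacent m b a
  adjacent-sym (inj₁ p) = inj₂ p
  adjacent-sym (inj₂ p) = inj₁ p

  adjacent-resp : ∀ {a a' b b'} → a ≡ a' [mod m ] → b ≡ b' [mod m ] → Adjacent m a b → Adjacent m a' b'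
  adjacent-resp a≡a' b≡b' (inj₁ p) = inj₁ (mod-trans (mod-sym b≡b') (mod-trans p (+-congʳ-mod 1 a≡a')))
  adjacent-resp a≡a' b≡b' (inj₂ p) = inj₂ (mod-trans (mod-sym a≡a') (mod-trans p (+-congʳ-mod 1 b≡b')))

  private
    +-+1 : ∀ a t → a + 1 + t ≡ a + t + 1
    +-+1 a t = trans (+-assoc a 1 t) (trans (cong (a +_) (+-comm 1 t)) (sym (+-assoc a t 1)))

  adjacent-+ : ∀ t {a b} → Adjacent m a b → Adjacent m (a + t) (b + t)
  adjacent-+ t {a} {b} (inj₁ p) = inj₁ (mod-trans (+-congʳ-mod t p) (≡⇒≡-mod (+-+1 a t)))
  adjacent-+ t {a} {b} (inj₂ p) = inj₂ (mod-trans (+-congʳ-mod t p) (≡⇒≡-mod (+-+1 b t)))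

  adjacent-+⁻ : ∀ t {a b} → Adjacent m (a + t) (b + t) → Adjacent m a b
  adjacent-+⁻ t {a} {b} (inj₁ p) = inj₁ (+-cancelʳ-mod t (mod-trans p (≡⇒≡-mod (sym (+-+1 a t)))))
  adjacent-+⁻ t {a} {b} (inj₂ p) = inj₂ (+-cancelʳ-mod t (mod-trans p (≡⇒≡-mod (sym (+-+1 b t)))))

  -- a' = t - a and b' = t - b, stated without subtraction.
  adjacent-reflect : ∀ t {a b a' b'} → a' + a ≡ t [mod m ] → b' + b ≡ t [mod m ] →
                     Adjacent m a b → Adjacent m a' b'
  adjacent-reflect t {a} {b} {a'} {b'} a'a b'b (inj₁ p) = inj₂ (+-cancelʳ-mod b (begin
    a' + b        ≈⟨ +-congˡ-mod a' p ⟩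
    a' + (a + 1)  ≡⟨ trans (sym (+-assoc a' a 1)) (+-comm (a' + a) 1) ⟩
    1 + (a' + a)  ≈⟨ +-congˡ-mod 1 (mod-trans a'a (mod-sym b'b)) ⟩
    1 + (b' + b)  ≡⟨ trans (sym (+-assoc 1 b' b)) (cong (_+ b) (+-comm 1 b')) ⟩
    b' + 1 + b    ∎))
    where open ≡-mod-Reasoning m
  adjacent-reflect t a'a b'b (inj₂ p) = adjacent-sym (adjacent-reflect t b'b a'a (inj₁ p))

  module _ (2≢0 : ¬ 2 ≡ 0 [mod m ]) where

    2+j≢j : ∀ j → ¬ suc (suc j) ≡ j [mod m ]
    2+j≢j j p = 2≢0 (+-cancelˡ-mod j (mod-trans (≡⇒≡-mod (+-comm j 2)) (mod-trans p (≡⇒≡-mod (sym (+-identityʳ j))))))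

    injective-walk-forward : (G : ℕ → ℕ) → (∀ j → Adjacent m (G j) (G (suc j))) →
                             (∀ {a b} → G a ≡ G b [mod m ] → a ≡ b [mod m ]) →
                             G 0 ≡ 0 [mod m ] → G 1 ≡ 1 [mod m ] → ∀ j → G j ≡ j [mod m ]
    injective-walk-forward G walk injective G0 G1 j = proj₁ (both j)
      where
      step : ∀ j → G j ≡ j [mod m ] → G (suc j) ≡ suc j [mod m ] → G (suc (suc j)) ≡ suc (suc j) [mod m ]
      step j Gj Gsj with walk (suc j)
      ... | inj₁ p = mod-trans p (mod-trans (+-congʳ-mod 1 Gsj) (≡⇒≡-mod (+-comm (suc j) 1)))
      ... | inj₂ p = contradiction (injective (+-cancelʳ-mod 1 (mod-sym (mod-trans Gj+1 (mod-trans (mod-sym Gsj) p)))))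
                                   (2+j≢j j)
        where
        Gj+1 : G j + 1 ≡ suc j [mod m ]
        Gj+1 = mod-trans (+-congʳ-mod 1 Gj) (≡⇒≡-mod (+-comm j 1))
      both : ∀ j → G j ≡ j [mod m ] × G (suc j) ≡ suc j [mod m ]
      both zero = G0 , G1
      both (suc j) with both j
      ... | Gj , Gsj = Gsj , step j Gj Gsj

    -- An injective walk along the m-cycle from 0 can never turn back (2 ≢ 0), so it is j ↦ j or j ↦ -j.
    injective-walk : (G : ℕ → ℕ) → (∀ j → Adjacent m (G j) (G (suc j))) →
                     (∀ {a b} → G a ≡ G b [mod m ] → a ≡ b [mod m ]) → G 0 ≡ 0 [mod m ] →
                     (∀ j → G j ≡ j [mod m ]) ⊎ (∀ j → G j + j ≡ 0 [mod m ])
    injective-walk G walk injective G0 with walk 0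
    ... | inj₁ G1 = inj₁ (injective-walk-forward G walk injective G0 (mod-trans G1 (+-congʳ-mod 1 G0)))
    ... | inj₂ G0≡G1+1 = inj₂ λ j → mod-trans (+-congˡ-mod (G j) (mod-sym (injective-walk-forward H H-walk H-injective H0 H1 j)))
                                              (+-neg-mod (G j))
      where
      -- The reflected walk -G starts with 0, 1, so the first case applies to it.
      H : ℕ → ℕ
      H j = neg m (G j)
      neg-inverse : ∀ a → neg m a + a ≡ 0 [mod m ]
      neg-inverse a = mod-trans (≡⇒≡-mod (+-comm (neg m a) a)) (+-neg-mod a)
      H-walk : ∀ j → Adjacent m (H j) (H (suc j))
      H-walk j = adjacent-reflect 0 (neg-inverse (G j)) (neg-inverse (G (suc j))) (walk j)
      H-injective : ∀ {a b} → H a ≡ H b [mod m ] → a ≡ b [mod m ]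
      H-injective {a} {b} p = injective (+-cancelˡ-mod (H a)
        (mod-trans (mod-trans (≡⇒≡-mod (+-comm (H a) (G a))) (+-neg-mod (G a)))
          (mod-trans (mod-sym (neg-inverse (G b))) (+-congʳ-mod (G b) (mod-sym p)))))
      H0 : H 0 ≡ 0 [mod m ]
      H0 = mod-trans (mod-sym (≡⇒≡-mod (+-identityʳ (H 0)))) (mod-trans (+-congˡ-mod (H 0) (mod-sym G0)) (neg-inverse (G 0)))
      H1 : H 1 ≡ 1 [mod m ]
      H1 = +-cancelʳ-mod (G 1)
        (mod-trans (neg-inverse (G 1)) (mod-trans (mod-sym G0) (mod-trans G0≡G1+1 (≡⇒≡-mod (+-comm (G 1) 1)))))

  private
    between : ∀ {a b w} → ¬ a ≡ b [mod m ] → Adjacent m a w → Adjacent m b w →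
              (w ≡ a + 1 [mod m ] × b ≡ w + 1 [mod m ]) ⊎ (a ≡ w + 1 [mod m ] × w ≡ b + 1 [mod m ])
    between a≢b (inj₁ p) (inj₁ q) = contradiction (+-cancelʳ-mod 1 (mod-trans (mod-sym p) q)) a≢b
    between a≢b (inj₁ p) (inj₂ q) = inj₁ (p , q)
    between a≢b (inj₂ p) (inj₁ q) = inj₂ (p , q)
    between a≢b (inj₂ p) (inj₂ q) = contradiction (mod-trans p (mod-sym q)) a≢b

    four-cycle : ∀ {a b w w'} → w ≡ a + 1 [mod m ] → b ≡ w + 1 [mod m ] →
                 a ≡ w' + 1 [mod m ] → w' ≡ b + 1 [mod m ] → 4 ≡ 0 [mod m ]
    four-cycle {a} {b} {w} {w'} p q r s = mod-sym (+-cancelˡ-mod a (begin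
      a + 0              ≡⟨ +-identityʳ a ⟩
      a                  ≈⟨ r ⟩
      w' + 1             ≈⟨ +-congʳ-mod 1 s ⟩
      b + 1 + 1          ≈⟨ +-congʳ-mod 1 (+-congʳ-mod 1 q) ⟩
      w + 1 + 1 + 1      ≈⟨ +-congʳ-mod 1 (+-congʳ-mod 1 (+-congʳ-mod 1 p)) ⟩
      a + 1 + 1 + 1 + 1  ≡⟨ trans (+-assoc (a + 1 + 1) 1 1) (trans (+-assoc (a + 1) 1 2) (+-assoc a 1 3)) ⟩
      a + 4              ∎))
      where open ≡-mod-Reasoning m

  adjacent-common-neighbour : ¬ 4 ≡ 0 [mod m ] → ∀ {a b w w'} → ¬ a ≡ b [mod m ] →
                              Adjacent m a w → Adjacent m b w → Adjacent m a w' → Adjacent m b w' →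
                              w ≡ w' [mod m ]
  adjacent-common-neighbour 4≢0 a≢b aw bw aw' bw' with between a≢b aw bw | between a≢b aw' bw'
  ... | inj₁ (w≡a+1 , _) | inj₁ (w'≡a+1 , _) = mod-trans w≡a+1 (mod-sym w'≡a+1)
  ... | inj₂ (_ , w≡b+1) | inj₂ (_ , w'≡b+1) = mod-trans w≡b+1 (mod-sym w'≡b+1)
  ... | inj₁ (w≡a+1 , b≡w+1) | inj₂ (a≡w'+1 , w'≡b+1) = contradiction (four-cycle w≡a+1 b≡w+1 a≡w'+1 w'≡b+1) 4≢0
  ... | inj₂ (a≡w+1 , w≡b+1) | inj₁ (w'≡a+1 , b≡w'+1) = contradiction (four-cycle w'≡a+1 b≡w'+1 a≡w+1 w≡b+1) 4≢0

Cycle : (n : ℕ) → Fin n → Fin n → Set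
Cycle n x y = (y ≡ x ⊕ 1) ⊎ (x ≡ y ⊕ 1)

module _ {k : ℕ} where

  cycle⇒adjacent : ∀ {x y : Fin (suc k)} → Cycle (suc k) x y → Adjacent (suc k) (toℕ x) (toℕ y)
  cycle⇒adjacent {x} {y} (inj₁ e) = inj₁ (≡⊕⇒≡-mod {i = x} e)
  cycle⇒adjacent {x} {y} (inj₂ e) = inj₂ (≡⊕⇒≡-mod {i = y} e)

  adjacent⇒cycle : ∀ {x y : Fin (suc k)} → Adjacent (suc k) (toℕ x) (toℕ y) → Cycle (suc k) x y
  adjacent⇒cycle {x} {y} (inj₁ p) = inj₁ (≡-mod⇒≡⊕ {i = x} p)
  adjacent⇒cycle {x} {y} (inj₂ p) = inj₂ (≡-mod⇒≡⊕ {i = y} p)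

  translation : ℕ → Automorphism (Cycle (suc k))
  translation t = record
    { fun = _⊕ t
    ; inv = _⊕ neg (suc k) t
    ; inverseˡ = λ x → ⊕-cancel x (mod-trans (≡⇒≡-mod (+-comm (neg (suc k) t) t)) (+-neg-mod t))
    ; inverseʳ = λ x → ⊕-cancel x (+-neg-mod t)
    ; adj = λ x y → mk⇔
        (λ e → adjacent⇒cycle (adjacent-resp (mod-sym (toℕ-⊕ x t)) (mod-sym (toℕ-⊕ y t)) (adjacent-+ t (cycle⇒adjacent e))))
        (λ e → adjacent⇒cycle (adjacent-+⁻ t (adjacent-resp (toℕ-⊕ x t) (toℕ-⊕ y t) (cycle⇒adjacent e))))
    }

  reflect : ℕ → Fin (suc k) → Fin (suc k)
  reflect t x = (t + neg (suc k) (toℕ x)) mod suc k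

  reflect-spec : ∀ t x → toℕ (reflect t x) + toℕ x ≡ t [mod suc k ]
  reflect-spec t x = begin
    toℕ (reflect t x) + toℕ x          ≈⟨ +-congʳ-mod (toℕ x) (toℕ-mod {suc k} (t + neg (suc k) (toℕ x))) ⟩
    t + neg (suc k) (toℕ x) + toℕ x    ≡⟨ +-assoc t (neg (suc k) (toℕ x)) (toℕ x) ⟩
    t + (neg (suc k) (toℕ x) + toℕ x)  ≡⟨ cong (t +_) (+-comm (neg (suc k) (toℕ x)) (toℕ x)) ⟩
    t + (toℕ x + neg (suc k) (toℕ x))  ≈⟨ +-congˡ-mod t (+-neg-mod (toℕ x)) ⟩
    t + 0                              ≡⟨ +-identityʳ t ⟩
    t                                  ∎
    where open ≡-mod-Reasoning (suc k)

  reflect-spec′ : ∀ t x → toℕ x + toℕ (reflect t x) ≡ t [mod suc k ]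
  reflect-spec′ t x = mod-trans (≡⇒≡-mod (+-comm (toℕ x) (toℕ (reflect t x)))) (reflect-spec t x)

  reflect-unique : ∀ t {x y} → toℕ y + toℕ x ≡ t [mod suc k ] → reflect t x ≡ y
  reflect-unique t {x} p = toℕ-injective-mod (+-cancelʳ-mod (toℕ x) (mod-trans (reflect-spec t x) (mod-sym p)))

  reflect-involutive : ∀ t x → reflect t (reflect t x) ≡ x
  reflect-involutive t x = reflect-unique t (reflect-spec′ t x)

  reflection : ℕ → Automorphism (Cycle (suc k))
  reflection t = record
    { fun = reflect t
    ; inv = reflect t
    ; inverseˡ = reflect-involutive t
    ; inverseʳ = reflect-involutive t
    ; adj = λ x y → mk⇔
        (λ e → adjacent⇒cycle (adjacent-reflect t (reflect-spec t x) (reflect-spec t y) (cycle⇒adjacent e)))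
        (λ e → adjacent⇒cycle (adjacent-reflect t (reflect-spec′ t x) (reflect-spec′ t y) (cycle⇒adjacent e)))
    }

  private
    translation-arc : ∀ {x y x' y' : Fin (suc k)} → y ≡ x ⊕ 1 → y' ≡ x' ⊕ 1 →
                      Σ (Automorphism (Cycle (suc k))) λ φ → (fun φ x ≡ x') × (fun φ y ≡ y')
    translation-arc {x} {y} {x'} {y'} refl refl = translation t , x↦x' , toℕ-injective-mod (begin
      toℕ ((x ⊕ 1) ⊕ t)  ≈⟨ toℕ-⊕ (x ⊕ 1) t ⟩
      toℕ (x ⊕ 1) + t    ≈⟨ +-congʳ-mod t (toℕ-⊕ x 1) ⟩
      toℕ x + 1 + t      ≡⟨ trans (+-assoc (toℕ x) 1 t) (trans (cong (toℕ x +_) (+-comm 1 t)) (sym (+-assoc (toℕ x) t 1))) ⟩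
      toℕ x + t + 1      ≈⟨ +-congʳ-mod 1 (toℕ-⊕ x t) ⟨
      toℕ (x ⊕ t) + 1    ≡⟨ cong (λ z → toℕ z + 1) x↦x' ⟩
      toℕ x' + 1         ≈⟨ toℕ-⊕ x' 1 ⟨
      toℕ (x' ⊕ 1)       ∎)
      where
      open ≡-mod-Reasoning (suc k)
      t = toℕ x' + neg (suc k) (toℕ x)
      x↦x' : x ⊕ t ≡ x'
      x↦x' = toℕ-injective-mod (begin
        toℕ (x ⊕ t)                             ≈⟨ toℕ-⊕ x t ⟩
        toℕ x + (toℕ x' + neg (suc k) (toℕ x))  ≡⟨ trans (sym (+-assoc (toℕ x) (toℕ x') _)) (cong (_+ neg (suc k) (toℕ x)) (+-comm (toℕ x) (toℕ x'))) ⟩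
        toℕ x' + toℕ x + neg (suc k) (toℕ x)    ≡⟨ +-assoc (toℕ x') (toℕ x) _ ⟩
        toℕ x' + (toℕ x + neg (suc k) (toℕ x))  ≈⟨ +-congˡ-mod (toℕ x') (+-neg-mod (toℕ x)) ⟩
        toℕ x' + 0                              ≡⟨ +-identityʳ (toℕ x') ⟩
        toℕ x'                                  ∎)

    reflection-arc : ∀ {x y x' y' : Fin (suc k)} → y ≡ x ⊕ 1 → x' ≡ y' ⊕ 1 →
                     Σ (Automorphism (Cycle (suc k))) λ φ → (fun φ x ≡ x') × (fun φ y ≡ y')
    reflection-arc {x} {y} {x'} {y'} refl refl = reflection t , reflect-unique t (≡⇒≡-mod refl) , reflect-unique t (begin
      toℕ y' + toℕ (x ⊕ 1)  ≈⟨ +-congˡ-mod (toℕ y') (toℕ-⊕ x 1) ⟩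
      toℕ y' + (toℕ x + 1)  ≡⟨ trans (cong (toℕ y' +_) (+-comm (toℕ x) 1)) (sym (+-assoc (toℕ y') 1 (toℕ x))) ⟩
      toℕ y' + 1 + toℕ x    ≈⟨ +-congʳ-mod (toℕ x) (toℕ-⊕ y' 1) ⟨
      toℕ (y' ⊕ 1) + toℕ x  ∎)
      where
      open ≡-mod-Reasoning (suc k)
      t = toℕ (y' ⊕ 1) + toℕ x

  cycle-arcTransitive : ArcTransitive (Cycle (suc k))
  cycle-arcTransitive x y x' y' (inj₁ p) (inj₁ q) = translation-arc p q
  cycle-arcTransitive x y x' y' (inj₁ p) (inj₂ q) = reflection-arc p q
  cycle-arcTransitive x y x' y' (inj₂ p) (inj₁ q) with reflection-arc p q
  ... | φ , φy , φx = φ , φx , φy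
  cycle-arcTransitive x y x' y' (inj₂ p) (inj₂ q) with translation-arc p q
  ... | φ , φy , φx = φ , φx , φy

  cycle-common-neighbour : ¬ 4 ≡ 0 [mod suc k ] → ∀ {x y w w' : Fin (suc k)} → ¬ x ≡ y →
                           Cycle (suc k) x w → Cycle (suc k) y w → Cycle (suc k) x w' → Cycle (suc k) y w' → w ≡ w'
  cycle-common-neighbour 4≢0 x≢y xw yw xw' yw' = toℕ-injective-mod
    (adjacent-common-neighbour 4≢0 (λ p → x≢y (toℕ-injective-mod p))
      (cycle⇒adjacent xw) (cycle⇒adjacent yw) (cycle⇒adjacent xw') (cycle⇒adjacent yw'))

  module _ (2≢0 : ¬ 2 ≡ 0 [mod suc k ]) where

    ⊕1≢⊕k : ∀ (x : Fin (suc k)) → ¬ x ⊕ 1 ≡ x ⊕ k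
    ⊕1≢⊕k x eq = 2≢0 (begin
      1 + 1  ≈⟨ +-congʳ-mod 1 1≡k ⟩
      k + 1  ≡⟨ +-comm k 1 ⟩
      suc k  ≈⟨ d≡0-mod ⟩
      0      ∎)
      where
      open ≡-mod-Reasoning (suc k)
      1≡k : 1 ≡ k [mod suc k ]
      1≡k = +-cancelˡ-mod (toℕ x) (mod-trans (mod-sym (toℕ-⊕ x 1)) (mod-trans (≡⇒≡-mod (cong toℕ eq)) (toℕ-⊕ x k)))

    cycle-stabilizer-element : Fin 2 → Automorphism (Cycle (suc k))
    cycle-stabilizer-element 0F = aut-id
    cycle-stabilizer-element 1F = reflection 0

    cycle-stabilizer : (g : Automorphism (Cycle (suc k))) → fun g 0F ≡ 0F →
                       Σ (Fin 2) λ b → SameAut g (cycle-stabilizer-element b)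
    cycle-stabilizer g g0 = conclude (injective-walk 2≢0 G walk G-injective G0)
      where
      G : ℕ → ℕ
      G j = toℕ (fun g (j mod suc k))
      walk : ∀ j → Adjacent (suc k) (G j) (G (suc j))
      walk j = cycle⇒adjacent (Equivalence.to (adj g (j mod suc k) (suc j mod suc k)) (inj₁ (mod-suc j)))
      G-injective : ∀ {a b} → G a ≡ G b [mod suc k ] → a ≡ b [mod suc k ]
      G-injective {a} {b} p = mod-trans (mod-sym (toℕ-mod a))
        (mod-trans (≡⇒≡-mod (cong toℕ (fun-injective g (toℕ-injective-mod p)))) (toℕ-mod b))
      G0 : G 0 ≡ 0 [mod suc k ]
      G0 = ≡⇒≡-mod (cong toℕ g0)
      G-toℕ : ∀ x → G (toℕ x) ≡ toℕ (fun g x)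
      G-toℕ x = cong (λ z → toℕ (fun g z)) (toℕ-mod-inverse x)
      conclude : (∀ j → G j ≡ j [mod suc k ]) ⊎ (∀ j → G j + j ≡ 0 [mod suc k ]) →
                 Σ (Fin 2) λ b → SameAut g (cycle-stabilizer-element b)
      conclude (inj₁ Gj≡j) = 0F , λ x → toℕ-injective-mod (mod-trans (≡⇒≡-mod (sym (G-toℕ x))) (Gj≡j (toℕ x)))
      conclude (inj₂ Gj+j≡0) = 1F , λ x → sym (reflect-unique 0
        (mod-trans (≡⇒≡-mod (cong (_+ toℕ x) (sym (G-toℕ x)))) (Gj+j≡0 (toℕ x))))

-- Automorphisms of C_m ⊗ K_4

module _ {k : ℕ} (2≢0 : ¬ 2 ≡ 0 [mod suc k ]) (4≢0 : ¬ 4 ≡ 0 [mod suc k ]) where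

  private
    E : Fin (suc k) × Fin 4 → Fin (suc k) × Fin 4 → Set
    E = Cycle (suc k) ⊗ Complete 4

  -- The common neighbours of vertices in different layers lie in one layer and avoid one label.
  same-layer-of-common-neighbours : ∀ {p q z₁ z₂ z₃ z₄} → Unique (z₁ ∷ z₂ ∷ z₃ ∷ z₄ ∷ []) →
                                    All.All (λ z → E p z × E q z) (z₁ ∷ z₂ ∷ z₃ ∷ z₄ ∷ []) → proj₁ p ≡ proj₁ q
  same-layer-of-common-neighbours {p} {q} {z₁} {z₂} {z₃} {z₄}
    ((z₁₂ All.∷ z₁₃ All.∷ z₁₄ All.∷ All.[]) AllPairs.∷ (z₂₃ All.∷ z₂₄ All.∷ All.[]) AllPairs.∷ (z₃₄ All.∷ All.[]) AllPairs.∷ _)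
    (a₁ All.∷ a₂ All.∷ a₃ All.∷ a₄ All.∷ All.[])
    with proj₁ p ≟ proj₁ q
  ... | yes p≡q = p≡q
  ... | no p≢q = contradiction (unique⇒length≤ labels-unique) λ { (s≤s (s≤s (s≤s (s≤s ())))) }
    where
    layer-z₁ : ∀ {z} → E p z × E q z → proj₁ z ≡ proj₁ z₁
    layer-z₁ (pz , qz) = cycle-common-neighbour 4≢0 p≢q (proj₁ pz) (proj₁ qz) (proj₁ (proj₁ a₁)) (proj₁ (proj₂ a₁))
    label-p : ∀ {z} → E p z × E q z → ¬ proj₂ p ≡ proj₂ z
    label-p (pz , _) = proj₂ pz
    labels-distinct : ∀ {z z'} → E p z × E q z → E p z' × E q z' → ¬ z ≡ z' → ¬ proj₂ z ≡ proj₂ z'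
    labels-distinct a a' z≢z' eq = z≢z' (cong₂ _,_ (trans (layer-z₁ a) (sym (layer-z₁ a'))) eq)
    labels-unique : Unique (proj₂ p ∷ proj₂ z₁ ∷ proj₂ z₂ ∷ proj₂ z₃ ∷ proj₂ z₄ ∷ [])
    labels-unique =
      (label-p a₁ All.∷ label-p a₂ All.∷ label-p a₃ All.∷ label-p a₄ All.∷ All.[]) AllPairs.∷
      (labels-distinct a₁ a₂ z₁₂ All.∷ labels-distinct a₁ a₃ z₁₃ All.∷ labels-distinct a₁ a₄ z₁₄ All.∷ All.[]) AllPairs.∷
      (labels-distinct a₂ a₃ z₂₃ All.∷ labels-distinct a₂ a₄ z₂₄ All.∷ All.[]) AllPairs.∷
      (labels-distinct a₃ a₄ z₃₄ All.∷ All.[]) AllPairs.∷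
      All.[] AllPairs.∷ AllPairs.[]

  -- (x, c) and (x, c') have the four common neighbours (x ± 1, d) with d ∉ {c, c'}.
  same-layer : (φ : Automorphism E) → ∀ x c c' → proj₁ (fun φ (x , c)) ≡ proj₁ (fun φ (x , c'))
  same-layer φ x c c' with c ≟ c'
  ... | yes refl = refl
  ... | no c≢c' with two-more-points c≢c'
  ... | d₁ , d₂ , c≢d₁ , c≢d₂ , c'≢d₁ , c'≢d₂ , d₁≢d₂ =
    same-layer-of-common-neighbours
      ((≢-image (λ eq → d₁≢d₂ (cong proj₂ eq)) All.∷ ≢-image (λ eq → ⊕1≢⊕k 2≢0 x (cong proj₁ eq))
         All.∷ ≢-image (λ eq → ⊕1≢⊕k 2≢0 x (cong proj₁ eq)) All.∷ All.[]) AllPairs.∷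
       (≢-image (λ eq → ⊕1≢⊕k 2≢0 x (cong proj₁ eq)) All.∷ ≢-image (λ eq → ⊕1≢⊕k 2≢0 x (cong proj₁ eq)) All.∷ All.[]) AllPairs.∷
       (≢-image (λ eq → d₁≢d₂ (cong proj₂ eq)) All.∷ All.[]) AllPairs.∷
       All.[] AllPairs.∷ AllPairs.[])
      (both (inj₁ refl) c≢d₁ c'≢d₁ All.∷ both (inj₁ refl) c≢d₂ c'≢d₂ All.∷
       both x~x⊕k c≢d₁ c'≢d₁ All.∷ both x~x⊕k c≢d₂ c'≢d₂ All.∷ All.[])
    where
    x~x⊕k : Cycle (suc k) x (x ⊕ k)
    x~x⊕k = inj₂ (sym ([x⊕k]⊕1≡x x))
    ≢-image : ∀ {z z'} → ¬ z ≡ z' → ¬ fun φ z ≡ fun φ z'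
    ≢-image z≢z' eq = z≢z' (fun-injective φ eq)
    both : ∀ {y d} → Cycle (suc k) x y → ¬ c ≡ d → ¬ c' ≡ d →
           E (fun φ (x , c)) (fun φ (y , d)) × E (fun φ (x , c')) (fun φ (y , d))
    both xy c≢d c'≢d = Equivalence.to (adj φ _ _) (xy , c≢d) , Equivalence.to (adj φ _ _) (xy , c'≢d)

  layer-map : Automorphism E → Fin (suc k) → Fin (suc k)
  layer-map φ x = proj₁ (fun φ (x , 0F))

  label-map : Automorphism E → Fin 4 → Fin 4
  label-map φ c = proj₂ (fun φ (0F , c))

  layer-map-adjacent : (φ : Automorphism E) → ∀ {x y} → Cycle (suc k) x y → Cycle (suc k) (layer-map φ x) (layer-map φ y)
  layer-map-adjacent φ {x} {y} xy =
    subst (Cycle (suc k) (layer-map φ x)) (same-layer φ y 1F 0F) (proj₁ (Equivalence.to (adj φ (x , 0F) (y , 1F)) (xy , λ ())))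

  layer-map-inverse : (φ : Automorphism E) → ∀ x → layer-map (aut-inverse φ) (layer-map φ x) ≡ x
  layer-map-inverse φ x = trans (same-layer (aut-inverse φ) (layer-map φ x) 0F (proj₂ (fun φ (x , 0F))))
                                (cong proj₁ (inverseʳ φ (x , 0F)))

  layer-aut : Automorphism E → Automorphism (Cycle (suc k))
  layer-aut φ = record
    { fun = layer-map φ
    ; inv = layer-map (aut-inverse φ)
    ; inverseˡ = layer-map-inverse (aut-inverse φ)
    ; inverseʳ = layer-map-inverse φ
    ; adj = λ x y → mk⇔ (layer-map-adjacent φ)
        (λ e → subst₂ (Cycle (suc k)) (layer-map-inverse φ x) (layer-map-inverse φ y) (layer-map-adjacent (aut-inverse φ) e))
    }

  -- φ (x, c) and φ (x + 1, c) are non-adjacent but lie in adjacent layers, so they carry the same label.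
  automorphism-shape : (φ : Automorphism E) → ∀ x c → fun φ (x , c) ≡ (layer-map φ x , label-map φ c)
  automorphism-shape φ x c = cong₂ _,_ (sym (same-layer φ x 0F c))
    (trans (cong (λ z → proj₂ (fun φ (z , c))) (sym (toℕ-mod-inverse x))) (label-constant (toℕ x)))
    where
    label-step : ∀ j → proj₂ (fun φ (suc j mod suc k , c)) ≡ proj₂ (fun φ (j mod suc k , c))
    label-step j with proj₂ (fun φ (j mod suc k , c)) ≟ proj₂ (fun φ (suc j mod suc k , c))
    ... | yes eq = sym eq
    ... | no ne = contradiction refl (proj₂ (Equivalence.from (adj φ _ _) (layers-adjacent , ne)))
      where
      layers-adjacent : Cycle (suc k) (proj₁ (fun φ (j mod suc k , c))) (proj₁ (fun φ (suc j mod suc k , c)))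
      layers-adjacent = subst₂ (Cycle (suc k)) (same-layer φ _ 0F c) (same-layer φ _ 0F c)
                          (layer-map-adjacent φ (inj₁ (mod-suc j)))
    label-constant : ∀ j → proj₂ (fun φ (j mod suc k , c)) ≡ label-map φ c
    label-constant zero = refl
    label-constant (suc j) = trans (label-step j) (label-constant j)

  label-map-inverse : (φ : Automorphism E) → ∀ c → label-map (aut-inverse φ) (label-map φ c) ≡ c
  label-map-inverse φ c = begin
    label-map (aut-inverse φ) (label-map φ c)       ≡⟨ cong proj₂ (automorphism-shape (aut-inverse φ) _ _) ⟨
    proj₂ (inv φ (layer-map φ 0F , label-map φ c))  ≡⟨ cong (λ z → proj₂ (inv φ z)) (automorphism-shape φ 0F c) ⟨
    proj₂ (inv φ (fun φ (0F , c)))                  ≡⟨ cong proj₂ (inverseʳ φ (0F , c)) ⟩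
    c                                               ∎
    where open ≡-Reasoning

  label-perm : Automorphism E → Permutation′ 4
  label-perm φ = Perm.permutation (label-map φ) (label-map (aut-inverse φ))
                   (label-map-inverse (aut-inverse φ)) (label-map-inverse φ)

  automorphism-decomposition : (φ : Automorphism E) → SameAut φ (layer-aut φ ⊗-aut perm-aut (label-perm φ))
  automorphism-decomposition φ (x , c) = automorphism-shape φ x c

  Stabilizer : Set
  Stabilizer = Σ (Automorphism E) λ φ → fun φ (0F , 0F) ≡ (0F , 0F)

  stabilizer-element : Fin 2 × LehmerCode 3 → Stabilizer
  stabilizer-element (b , c) =
    cycle-stabilizer-element 2≢0 b ⊗-aut perm-aut (decode (0F ∷ c)) ,
    cong₂ _,_ (fixes-0 b) (insert-matchˡ 0F 0F (decode c))
    where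
    fixes-0 : ∀ b → fun (cycle-stabilizer-element 2≢0 b) 0F ≡ 0F
    fixes-0 0F = refl
    fixes-0 1F = reflect-unique 0 (≡⇒≡-mod refl)

  stabilizer-element-injective : ∀ i j → SameAut (proj₁ (stabilizer-element i)) (proj₁ (stabilizer-element j)) → i ≡ j
  stabilizer-element-injective (b , c) (b' , c') same =
    cong₂ _,_ (reflection-flag-injective b b' (cong proj₁ (same (one , 0F))))
              (∷-tail (decode-injective (0F ∷ c) (0F ∷ c') (λ d → cong proj₂ (same (0F , d)))))
    where
    ∷-tail : ∀ {c c' : LehmerCode 3} → 0F ∷ c ≡ 0F ∷ c' → c ≡ c'
    ∷-tail refl = refl
    one : Fin (suc k)
    one = 0F ⊕ 1
    1≢-1 : ¬ one ≡ reflect 0 one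
    1≢-1 eq = 2≢0 (begin
      1 + 1                          ≈⟨ +-cong-mod (toℕ-⊕ {k} 0F 1) (toℕ-⊕ {k} 0F 1) ⟨
      toℕ one + toℕ one              ≡⟨ cong (λ z → toℕ z + toℕ one) eq ⟩
      toℕ (reflect 0 one) + toℕ one  ≈⟨ reflect-spec 0 one ⟩
      0                              ∎)
      where open ≡-mod-Reasoning (suc k)
    reflection-flag-injective : ∀ b b' → fun (cycle-stabilizer-element 2≢0 b) one ≡ fun (cycle-stabilizer-element 2≢0 b') one →
                                b ≡ b'
    reflection-flag-injective 0F 0F _ = refl
    reflection-flag-injective 0F 1F eq = contradiction eq 1≢-1
    reflection-flag-injective 1F 0F eq = contradiction (sym eq) 1≢-1
    reflection-flag-injective 1F 1F _ = refl

  stabilizer-element-surjective : ∀ (φ : Automorphism E) → fun φ (0F , 0F) ≡ (0F , 0F) →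
                                  Σ (Fin 2 × LehmerCode 3) λ i → SameAut φ (proj₁ (stabilizer-element i))
  stabilizer-element-surjective φ φ0 = (proj₁ layer-code , code-tail (proj₁ label-code)) , λ { (x , d) →
    trans (automorphism-decomposition φ (x , d)) (cong₂ _,_ (proj₂ layer-code x) (trans (proj₂ label-code d)
      (cong (λ i → insert 0F i (decode (code-tail (proj₁ label-code))) ⟨$⟩ʳ d) (cong proj₂ φ0)))) }
    where
    layer-code = cycle-stabilizer 2≢0 (layer-aut φ) (cong proj₁ φ0)
    label-code = decode-surjective (label-perm φ)
    code-tail : LehmerCode 4 → LehmerCode 3
    code-tail (_ ∷ c) = c

  -- Opaque, so that type checking never unfolds the twelve elements of the stabilizer.
  opaque
    indices : List (Fin 2 × LehmerCode 3)
    indices = cartesianProduct (allFin 2) (allCodes 3)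

    indices-unique : Unique indices
    indices-unique = Unique.cartesianProduct⁺ (Unique.allFin⁺ 2) (allCodes-unique 3)

    ∈-indices : ∀ i → i ∈ indices
    ∈-indices (b , c) = ∈-cartesianProduct⁺ (∈-allFin b) (∈-allCodes c)

    length-indices : length indices ≡ 12
    length-indices = refl

  stabilizer-list-distinct : AllPairs.AllPairs (λ p q → ¬ SameAut (proj₁ p) (proj₁ q)) (map stabilizer-element indices)
  stabilizer-list-distinct = AllPairs.map⁺ {f = stabilizer-element}
    (AllPairs.map (λ {i} {j} i≢j same → i≢j (stabilizer-element-injective i j same)) indices-unique)

  stabilizer-list-complete : ∀ φ → (Σ (Fin 2 × LehmerCode 3) λ i → SameAut φ (proj₁ (stabilizer-element i))) →
                             Any (λ p → SameAut φ (proj₁ p)) (map stabilizer-element indices)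
  stabilizer-list-complete φ (i , same) = Any.map⁺ {f = stabilizer-element}
    (Any.map (λ { refl → same }) (∈-indices i))

  stabilizerOrder-origin : StabilizerOrder E (0F , 0F) 12
  stabilizerOrder-origin =
    map stabilizer-element indices ,
    trans (length-map stabilizer-element indices) length-indices ,
    stabilizer-list-distinct ,
    λ φ φ0 → stabilizer-list-complete φ (stabilizer-element-surjective φ φ0)

  stabilizerOrder : ∀ v → StabilizerOrder E v 12
  stabilizerOrder (x , c) = stabilizerOrder-invariant ψ (x , c) 12
    (subst (λ v → StabilizerOrder E v 12) (sym (cong₂ _,_ x↦0 (insert-matchˡ c 0F Perm.id))) stabilizerOrder-origin)
    where
    ψ : Automorphism E
    ψ = translation (neg (suc k) (toℕ x)) ⊗-aut perm-aut (insert c 0F Perm.id)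
    x↦0 : x ⊕ neg (suc k) (toℕ x) ≡ 0F
    x↦0 = toℕ-injective-mod (mod-trans (toℕ-⊕ x _) (+-neg-mod (toℕ x)))

-- The Nest graph N(2m; 2, m, m + 2; 1)

parity : ℕ → Fin 2
parity a = a mod 2

parity-injective : ∀ {a b} → parity a ≡ parity b → a ≡ b [mod 2 ]
parity-injective {a} {b} eq = mod-trans (mod-sym (toℕ-mod a)) (mod-trans (≡⇒≡-mod (cong toℕ eq)) (toℕ-mod b))

parity-cong : ∀ {a b} → a ≡ b [mod 2 ] → parity a ≡ parity b
parity-cong {a} {b} p = toℕ-injective-mod (mod-trans (toℕ-mod a) (mod-trans p (mod-sym (toℕ-mod b))))

parity-↑ˡ⇔ : ∀ a b → a ≡ b [mod 2 ] ⇔ (parity a ↑ˡ 2 ≡ parity b ↑ˡ 2)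
parity-↑ˡ⇔ a b = mk⇔ (λ p → cong (_↑ˡ 2) (parity-cong p)) (λ eq → parity-injective (↑ˡ-injective 2 _ _ eq))

parity-↑ʳ⇔ : ∀ a b → a ≡ b [mod 2 ] ⇔ (2 ↑ʳ parity a ≡ 2 ↑ʳ parity b)
parity-↑ʳ⇔ a b = mk⇔ (λ p → cong (2 ↑ʳ_) (parity-cong p)) (λ eq → parity-injective (↑ʳ-injective 2 _ _ eq))

↑ˡ≢↑ʳ : ∀ (a b : Fin 2) → ¬ a ↑ˡ 2 ≡ 2 ↑ʳ b
↑ˡ≢↑ʳ a b eq with trans (sym (splitAt-↑ˡ 2 a 2)) (trans (cong (splitAt 2) eq) (splitAt-↑ʳ 2 2 b))
... | ()

module _ {k : ℕ} (m-odd : ¬ 2 ∣ suc k) where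

  private
    m : ℕ
    m = suc k

  ⊕⇒≡-mod : ∀ {i j : Fin (2 * m)} {a} → j ≡ i ⊕ a → toℕ j ≡ toℕ i + a [mod m ] × toℕ j ≡ toℕ i + a [mod 2 ]
  ⊕⇒≡-mod {i} eq = ≡-mod-∣ (n∣m*n 2) (≡⊕⇒≡-mod {i = i} eq) , ≡-mod-∣ (m∣m*n m) (≡⊕⇒≡-mod {i = i} eq)

  ≡-mod⇒⊕ : ∀ {i j : Fin (2 * m)} {a} → toℕ j ≡ toℕ i + a [mod m ] → toℕ j ≡ toℕ i + a [mod 2 ] → j ≡ i ⊕ a
  ≡-mod⇒⊕ {i} p q = ≡-mod⇒≡⊕ {i = i} (crt-mod m-odd p q)

  step⇔ : ∀ {i j : Fin (2 * m)} →
          ((j ≡ i ⊕ 1) ⊎ (i ≡ j ⊕ 1)) ⇔ (Adjacent m (toℕ i) (toℕ j) × ¬ toℕ i ≡ toℕ j [mod 2 ])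
  step⇔ {i} {j} = mk⇔ to from
    where
    to : (j ≡ i ⊕ 1) ⊎ (i ≡ j ⊕ 1) → Adjacent m (toℕ i) (toℕ j) × ¬ toℕ i ≡ toℕ j [mod 2 ]
    to (inj₁ eq) = let (p , q) = ⊕⇒≡-mod {i = i} eq in
      inj₁ p , λ i≡j → ≢+1-mod-2 (toℕ j) (mod-trans q (+-congʳ-mod 1 i≡j))
    to (inj₂ eq) = let (p , q) = ⊕⇒≡-mod {i = j} eq in
      inj₂ p , λ i≡j → ≢+1-mod-2 (toℕ j) (mod-trans (mod-sym i≡j) q)
    from : Adjacent m (toℕ i) (toℕ j) × ¬ toℕ i ≡ toℕ j [mod 2 ] → (j ≡ i ⊕ 1) ⊎ (i ≡ j ⊕ 1)
    from (inj₁ p , i≢j) = inj₁ (≡-mod⇒⊕ {i = i} p (≢-mod-2⇒+1 (λ j≡i → i≢j (mod-sym j≡i))))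
    from (inj₂ p , i≢j) = inj₂ (≡-mod⇒⊕ {i = j} p (≢-mod-2⇒+1 i≢j))

  -- The hypotheses on b say that b ≡ a + m modulo 2m.
  offset⇔ : ∀ {i j : Fin (2 * m)} a b → b ≡ a + 1 [mod 2 ] → b ≡ a [mod m ] →
            ((j ≡ i ⊕ a) ⊎ (j ≡ i ⊕ b)) ⇔ toℕ j ≡ toℕ i + a [mod m ]
  offset⇔ {i} {j} a b b≡a+1 b≡a = mk⇔ to from
    where
    to : (j ≡ i ⊕ a) ⊎ (j ≡ i ⊕ b) → toℕ j ≡ toℕ i + a [mod m ]
    to (inj₁ eq) = proj₁ (⊕⇒≡-mod {i = i} eq)
    to (inj₂ eq) = mod-trans (proj₁ (⊕⇒≡-mod {i = i} eq)) (+-congˡ-mod (toℕ i) b≡a)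
    from : toℕ j ≡ toℕ i + a [mod m ] → (j ≡ i ⊕ a) ⊎ (j ≡ i ⊕ b)
    from p with mod-2-dichotomy (toℕ j) (toℕ i + a)
    ... | inj₁ q = inj₁ (≡-mod⇒⊕ {i = i} p q)
    ... | inj₂ q = inj₂ (≡-mod⇒⊕ {i = i} (mod-trans p (+-congˡ-mod (toℕ i) (mod-sym b≡a)))
                          (mod-trans q (mod-trans (≡⇒≡-mod (+-assoc (toℕ i) a 1)) (+-congˡ-mod (toℕ i) (mod-sym b≡a+1)))))

  a+k+1≡a : ∀ a → a + k + 1 ≡ a [mod m ]
  a+k+1≡a a = mod-trans (≡⇒≡-mod (trans (+-assoc a k 1) (cong (a +_) (+-comm k 1)))) (+-d-mod a)

  adjacent-pred⇔ : ∀ a b → Adjacent m a (b + k) ⇔ (b ≡ a [mod m ] ⊎ b ≡ a + 2 [mod m ])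
  adjacent-pred⇔ a b = mk⇔ to from
    where
    to : Adjacent m a (b + k) → b ≡ a [mod m ] ⊎ b ≡ a + 2 [mod m ]
    to (inj₁ p) = inj₂ (mod-trans (mod-sym (a+k+1≡a b)) (mod-trans (+-congʳ-mod 1 p) (≡⇒≡-mod (+-assoc a 1 1))))
    to (inj₂ p) = inj₁ (mod-sym (mod-trans p (a+k+1≡a b)))
    from : b ≡ a [mod m ] ⊎ b ≡ a + 2 [mod m ] → Adjacent m a (b + k)
    from (inj₁ p) = inj₂ (mod-trans (mod-sym p) (mod-sym (a+k+1≡a b)))
    from (inj₂ p) = inj₁ (+-cancelʳ-mod 1 (mod-trans (a+k+1≡a b) (mod-trans p (≡⇒≡-mod (sym (+-assoc a 1 1))))))

  nest-uv⇔ : ∀ (i j : Fin (2 * m)) →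
             ((j ≡ i) ⊎ (j ≡ i ⊕ 2) ⊎ (j ≡ i ⊕ m) ⊎ (j ≡ i ⊕ (m + 2))) ⇔ Adjacent m (toℕ i) (toℕ j + k)
  nest-uv⇔ i j = mk⇔ to from
    where
    offset-0 = offset⇔ {i} {j} 0 m (odd⇒≡1-mod-2 m-odd) d≡0-mod
    offset-2 = offset⇔ {i} {j} 2 (m + 2) (+-congʳ-mod 2 (odd⇒≡1-mod-2 m-odd)) (+-congʳ-mod 2 d≡0-mod)
    j≡i-mod : toℕ j ≡ toℕ i + 0 [mod m ] → toℕ j ≡ toℕ i [mod m ]
    j≡i-mod p = mod-trans p (≡⇒≡-mod (+-identityʳ (toℕ i)))
    to : (j ≡ i) ⊎ (j ≡ i ⊕ 2) ⊎ (j ≡ i ⊕ m) ⊎ (j ≡ i ⊕ (m + 2)) → Adjacent m (toℕ i) (toℕ j + k)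
    to (inj₁ j≡i) = Equivalence.from (adjacent-pred⇔ _ _) (inj₁ (≡⇒≡-mod (cong toℕ j≡i)))
    to (inj₂ (inj₁ e)) = Equivalence.from (adjacent-pred⇔ _ _) (inj₂ (Equivalence.to offset-2 (inj₁ e)))
    to (inj₂ (inj₂ (inj₁ e))) = Equivalence.from (adjacent-pred⇔ _ _) (inj₁ (j≡i-mod (Equivalence.to offset-0 (inj₂ e))))
    to (inj₂ (inj₂ (inj₂ e))) = Equivalence.from (adjacent-pred⇔ _ _) (inj₂ (Equivalence.to offset-2 (inj₂ e)))
    from : Adjacent m (toℕ i) (toℕ j + k) → (j ≡ i) ⊎ (j ≡ i ⊕ 2) ⊎ (j ≡ i ⊕ m) ⊎ (j ≡ i ⊕ (m + 2))
    from adjacent with Equivalence.to (adjacent-pred⇔ _ _) adjacent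
    ... | inj₁ p with Equivalence.from offset-0 (mod-trans p (≡⇒≡-mod (sym (+-identityʳ (toℕ i)))))
    ...   | inj₁ e = inj₁ (trans e (⊕-identityʳ i))
    ...   | inj₂ e = inj₂ (inj₂ (inj₁ e))
    from adjacent | inj₂ p with Equivalence.from offset-2 p
    ...   | inj₁ e = inj₂ (inj₁ e)
    ...   | inj₂ e = inj₂ (inj₂ (inj₂ e))

  encode : Vtx (2 * m) → Fin m × Fin 4
  encode (u i) = toℕ i mod m , parity (toℕ i) ↑ˡ 2
  encode (v j) = (toℕ j + k) mod m , 2 ↑ʳ parity (toℕ j)

  crt-lift : Fin m → Fin 2 → Fin (2 * m)
  crt-lift x e with mod-2-dichotomy (toℕ x) (toℕ e)
  ... | inj₁ _ = fromℕ< (≤-trans (toℕ<n x) (m≤m+n m (m + 0)))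
  ... | inj₂ _ = fromℕ< (subst (toℕ x + m <_) (cong (m +_) (sym (+-identityʳ m))) (+-monoˡ-< m (toℕ<n x)))

  crt-lift-mod-m : ∀ x e → toℕ (crt-lift x e) ≡ toℕ x [mod m ]
  crt-lift-mod-m x e with mod-2-dichotomy (toℕ x) (toℕ e)
  ... | inj₁ _ = ≡⇒≡-mod (toℕ-fromℕ< _)
  ... | inj₂ _ = mod-trans (≡⇒≡-mod (toℕ-fromℕ< _)) (+-d-mod (toℕ x))

  crt-lift-mod-2 : ∀ x e → toℕ (crt-lift x e) ≡ toℕ e [mod 2 ]
  crt-lift-mod-2 x e with mod-2-dichotomy (toℕ x) (toℕ e)
  ... | inj₁ x≡e = mod-trans (≡⇒≡-mod (toℕ-fromℕ< _)) x≡e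
  ... | inj₂ x≡e+1 = begin
    toℕ (fromℕ< _)  ≡⟨ toℕ-fromℕ< _ ⟩
    toℕ x + m       ≈⟨ +-congˡ-mod (toℕ x) (odd⇒≡1-mod-2 m-odd) ⟩
    toℕ x + 1       ≈⟨ +-congʳ-mod 1 x≡e+1 ⟩
    toℕ e + 1 + 1   ≡⟨ +-assoc (toℕ e) 1 1 ⟩
    toℕ e + 2       ≈⟨ +-d-mod (toℕ e) ⟩
    toℕ e           ∎
    where open ≡-mod-Reasoning 2

  crt-lift-unique : ∀ {x e i} → toℕ i ≡ toℕ x [mod m ] → toℕ i ≡ toℕ e [mod 2 ] → crt-lift x e ≡ i
  crt-lift-unique {x} {e} p q = toℕ-injective-mod (crt-mod m-odd
    (mod-trans (crt-lift-mod-m x e) (mod-sym p)) (mod-trans (crt-lift-mod-2 x e) (mod-sym q)))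

  encode⁻¹ : Fin m × Fin 4 → Vtx (2 * m)
  encode⁻¹ (x , c) = [ (λ e → u (crt-lift x e)) , (λ e → v (crt-lift (x ⊕ 1) e)) ]′ (splitAt 2 c)

  encode⁻¹∘encode : ∀ p → encode⁻¹ (encode p) ≡ p
  encode⁻¹∘encode (u i) rewrite splitAt-↑ˡ 2 (parity (toℕ i)) 2 =
    cong u (crt-lift-unique (mod-sym (toℕ-mod (toℕ i))) (mod-sym (toℕ-mod (toℕ i))))
  encode⁻¹∘encode (v j) rewrite splitAt-↑ʳ 2 2 (parity (toℕ j)) =
    cong v (crt-lift-unique (mod-sym (begin
      toℕ (((toℕ j + k) mod m) ⊕ 1)  ≈⟨ toℕ-⊕ ((toℕ j + k) mod m) 1 ⟩
      toℕ ((toℕ j + k) mod m) + 1    ≈⟨ +-congʳ-mod 1 (toℕ-mod (toℕ j + k)) ⟩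
      toℕ j + k + 1                  ≈⟨ a+k+1≡a (toℕ j) ⟩
      toℕ j                          ∎))
      (mod-sym (toℕ-mod (toℕ j))))
    where open ≡-mod-Reasoning m

  encode∘encode⁻¹ : ∀ q → encode (encode⁻¹ q) ≡ q
  encode∘encode⁻¹ (x , c) with splitAt 2 c in eq
  ... | inj₁ e = cong₂ _,_
    (toℕ-injective-mod (mod-trans (toℕ-mod _) (crt-lift-mod-m x e)))
    (trans (cong (_↑ˡ 2) (toℕ-injective-mod (mod-trans (toℕ-mod _) (crt-lift-mod-2 x e)))) (splitAt⁻¹-↑ˡ eq))
  ... | inj₂ e = cong₂ _,_
    (toℕ-injective-mod (begin
      toℕ ((toℕ (crt-lift (x ⊕ 1) e) + k) mod m)  ≈⟨ toℕ-mod _ ⟩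
      toℕ (crt-lift (x ⊕ 1) e) + k                ≈⟨ +-congʳ-mod k (crt-lift-mod-m (x ⊕ 1) e) ⟩
      toℕ (x ⊕ 1) + k                             ≈⟨ +-congʳ-mod k (toℕ-⊕ x 1) ⟩
      toℕ x + 1 + k                               ≡⟨ trans (+-assoc (toℕ x) 1 k) (sym (trans (+-assoc (toℕ x) k 1) (cong (toℕ x +_) (+-comm k 1)))) ⟩
      toℕ x + k + 1                               ≈⟨ a+k+1≡a (toℕ x) ⟩
      toℕ x                                       ∎))
    (trans (cong (2 ↑ʳ_) (toℕ-injective-mod (mod-trans (toℕ-mod _) (crt-lift-mod-2 (x ⊕ 1) e)))) (splitAt⁻¹-↑ʳ eq))
    where open ≡-mod-Reasoning m

  cycle-mod⇔ : ∀ a b → Adjacent m a b ⇔ Cycle m (a mod m) (b mod m)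
  cycle-mod⇔ a b = mk⇔
    (λ ab → adjacent⇒cycle (adjacent-resp (mod-sym (toℕ-mod a)) (mod-sym (toℕ-mod b)) ab))
    (λ ab → adjacent-resp (toℕ-mod a) (toℕ-mod b) (cycle⇒adjacent ab))

  adjacent-+⇔ : ∀ a b → Adjacent m a b ⇔ Adjacent m (a + k) (b + k)
  adjacent-+⇔ a b = mk⇔ (adjacent-+ k) (adjacent-+⁻ k)

  adjacent-sym⇔ : ∀ a b → Adjacent m a b ⇔ Adjacent m b a
  adjacent-sym⇔ a b = mk⇔ adjacent-sym adjacent-sym

  encode-adjacency : ∀ p q → NestAdj (2 * m) 2 m (m + 2) 1 p q ⇔ (Cycle m ⊗ Complete 4) (encode p) (encode q)
  encode-adjacency (u i) (u j) =
    (cycle-mod⇔ (toℕ i) (toℕ j) ×-⇔ ¬-cong-⇔ (parity-↑ˡ⇔ (toℕ i) (toℕ j))) ⇔-∘ step⇔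
  encode-adjacency (v i) (v j) =
    ((cycle-mod⇔ (toℕ i + k) (toℕ j + k) ⇔-∘ adjacent-+⇔ (toℕ i) (toℕ j)) ×-⇔ ¬-cong-⇔ (parity-↑ʳ⇔ (toℕ i) (toℕ j)))
      ⇔-∘ step⇔
  encode-adjacency (u i) (v j) =
    mk⇔ (λ e → e , ↑ˡ≢↑ʳ _ _) proj₁ ⇔-∘ (cycle-mod⇔ (toℕ i) (toℕ j + k) ⇔-∘ nest-uv⇔ i j)
  encode-adjacency (v j) (u i) =
    mk⇔ (λ e → e , λ eq → ↑ˡ≢↑ʳ _ _ (sym eq)) proj₁
      ⇔-∘ (cycle-mod⇔ (toℕ j + k) (toℕ i) ⇔-∘ (adjacent-sym⇔ _ _ ⇔-∘ nest-uv⇔ i j))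

  nest-iso : Iso (NestAdj (2 * m) 2 m (m + 2) 1) (Cycle m ⊗ Complete 4)
  nest-iso = record
    { to = encode ; from = encode⁻¹ ; to∘from = encode∘encode⁻¹ ; from∘to = encode⁻¹∘encode ; adjacency = encode-adjacency }

odd-∤4 : ∀ {m} → 3 ≤ m → ¬ 2 ∣ m → ¬ m ∣ 4
odd-∤4 {0} () _
odd-∤4 {1} (s≤s ()) _
odd-∤4 {2} (s≤s (s≤s ())) _
odd-∤4 {3} _ _ (divides 0 ())
odd-∤4 {3} _ _ (divides 1 ())
odd-∤4 {3} _ _ (divides (suc (suc q)) ())
odd-∤4 {4} _ m-odd _ = m-odd (divides 2 refl)
odd-∤4 {suc (suc (suc (suc (suc m))))} _ _ m∣4 with ∣⇒≤ m∣4
... | s≤s (s≤s (s≤s (s≤s ())))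

lemma3p3 : (m : ℕ) → 3 ≤ m → ¬ (2 ∣ m) →
    ArcTransitive (NestAdj (2 * m) 2 m (m + 2) 1) ×
    (∀ (x : Vtx (2 * m)) → StabilizerOrder (NestAdj (2 * m) 2 m (m + 2) 1) x 12)
lemma3p3 zero () _
lemma3p3 (suc k) 3≤m m-odd =
  arcTransitive-transport (nest-iso m-odd) (⊗-arcTransitive cycle-arcTransitive (complete-arcTransitive 4)) ,
  λ x → stabilizerOrder-transport (nest-iso m-odd) x 12 (stabilizerOrder 2≢0 4≢0 (Iso.to (nest-iso m-odd) x))
  where
  2≢0 : ¬ 2 ≡ 0 [mod suc k ]
  2≢0 p = <⇒≱ 3≤m (∣⇒≤ (≡0-mod⇒∣ p))
  4≢0 : ¬ 4 ≡ 0 [mod suc k ]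
  4≢0 p = odd-∤4 3≤m m-odd (≡0-mod⇒∣ p)
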